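{- Let $j,k$ be integers with $k+250<j<3k/2$, $j\ge 212299$ and $k\ge 141534$. Let $G$ be a complete graph on $4j+1$ vertices whose edges are colored red and blue such that the red subgraph contains no cycle $C_{2k+1}$ and the blue subgraph contains no wheel $W_{2j}$. Let $v$ be a vertex of $G$ of maximum blue degree and let $H$ be the subgraph induced on the blue neighborhood $N^B(v)$. Let $a,b$ be vertices of $H$ joined by a red edge, each having fewer than $j$ blue neighbors in $H$. Let $C$ be a red cycle of length $2j-502$ in $H-a-b$, with vertices labeled by $\mathbb{Z}/(2j-502)\mathbb{Z}$ so that $i$ and $i+1$ are consecutive on $C$. For each label $i$ set $A_i=1$ if the edge $ai$ is red and $A_i=0$ if it is blue, and $B_i=1$ if $bi$ is red and $B_i=0$ if blue. Then $|\{x: A_x=A_{x+2k-1}\}|\le 500$ and $|\{x: B_x=B_{x+2k-1}\}|\le 500$.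
   Context: $C_m$ is the cycle of length $m$; the wheel $W_{n}$ consists of a cycle $C_n$ together with a hub vertex adjacent to all cycle vertices. Indices of labels are taken modulo $2j-502$. -}

module Defs where

open import Data.Nat using (ℕ; zero; suc; _+_; _*_; _∸_; _<_; _≤_; NonZero)
open import Data.Nat.DivMod using (_%_; m%n<n)
open import Data.Fin using (Fin; toℕ; fromℕ<)
open import Data.Bool using (Bool; true; false; not; T)
open import Data.Product using (Σ; _×_; _,_)
open import Data.List using (List; filter; length)
open import Data.List using () renaming (allFin to allFinL)
open import Relation.Binary.PropositionalEquality using (_≡_; _≢_)
open import Relation.Nullary using (¬_; Dec; yes; no)
open import Relation.Nullary.Decidable using (⌊_⌋)
open import Function.Definitions using (Injective)
open import Data.Fin using (_≟_)
open import Data.Bool using (_∧_)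
import Data.Bool as B

-- A red/blue colouring of the edges of the complete graph on Fin n:
-- red u v = true means the edge uv is red; for u ≢ v, red u v = false means blue.
-- Only the values on pairs of distinct vertices are meaningful.
record Colouring (n : ℕ) : Set where
  field
    red : Fin n → Fin n → Bool
    sym : ∀ u v → red u v ≡ red v u

open Colouring public

IsRed : ∀ {n} → Colouring n → Fin n → Fin n → Set
IsRed G u v = (u ≢ v) × (red G u v ≡ true)

IsBlue : ∀ {n} → Colouring n → Fin n → Fin n → Set
IsBlue G u v = (u ≢ v) × (red G u v ≡ false)

-- successor modulo m on Fin m (m ≥ 1)
-- (Fin 0 is empty, so the zero case is vacuous)
sucMod : ∀ {m} → Fin m → Fin m
sucMod {suc m} i = fromℕ< (m%n<n (suc (toℕ i)) (suc m))

addMod : ∀ {m} → Fin m → ℕ → Fin m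
addMod {suc m} i d = fromℕ< (m%n<n (toℕ i + d) (suc m))

HasRedCycle : ∀ {n} → Colouring n → (m : ℕ) → Set
HasRedCycle {n} G m =
  Σ (Fin m → Fin n) λ c → Injective _≡_ _≡_ c × (∀ i → IsRed G (c i) (c (sucMod i)))

HasBlueWheel : ∀ {n} → Colouring n → (m : ℕ) → Set
HasBlueWheel {n} G m =
  Σ (Fin n) λ h → Σ (Fin m → Fin n) λ c →
    Injective _≡_ _≡_ c × (∀ i → IsBlue G (c i) (c (sucMod i)))
      × (∀ i → IsBlue G h (c i))

blue? : ∀ {n} → Colouring n → Fin n → Fin n → Bool
blue? G u v = not ⌊ u ≟ v ⌋ ∧ not (red G u v)

count : ∀ {n} → (Fin n → Bool) → ℕ
count {n} p = length (filter (λ x → T? (p x)) (allFinL n))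
  where
  T? : (b : Bool) → Dec (T b)
  T? true = yes _
  T? false = no (λ ())

blueDeg : ∀ {n} → Colouring n → Fin n → ℕ
blueDeg G v = count (λ u → blue? G v u)

-- blue degree of u inside H = G[N^B(v)]
blueDegIn : ∀ {n} → Colouring n → Fin n → Fin n → ℕ
blueDegIn G v u = count (λ w → blue? G v w ∧ blue? G u w)

_=ᵇ_ : Bool → Bool → Bool
true  =ᵇ b = b
false =ᵇ b = not b

module Submission where

-- If a were red to both c x and c (x + 2k − 1), then a together with the red arc
-- c x, c (x + 1), …, c (x + 2k − 1) of C would be a red C_{2k+1}. So for every x at least one
-- of A_x, A_{x+2k−1} is 0, and both are 0 when they agree. Summing over x gives
-- #{x : A_x = A_{x+2k−1}} + |C| ≤ 2 · #{x : A_x = 0}, and the edges a(c x) with A_x = 0 are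
-- blue edges of a inside H, so the right side is at most 2(j − 1); with |C| = 2j − 502 the
-- bound 500 follows.

open import Defs hiding (sym)
open import Data.Bool using (Bool; true; false; T; not; _∧_)
open import Data.Bool.Properties using (T-∧; T-not-≡)
open import Data.Empty using (⊥)
open import Data.Fin using (Fin; toℕ)
import Data.Fin as Fin
open import Data.Fin.Properties using (toℕ-fromℕ<; toℕ-injective; toℕ<n)
open import Data.List using (List; []; _∷_; filter; length; map; allFin)
open import Data.List.Properties using (length-map; length-tabulate; length-removeAt′)
open import Data.List.Membership.Propositional using (_∈_)
open import Data.List.Membership.Propositional.Properties using (∈-filter⁺; ∈-filter⁻; ∈-map⁻; ∈-allFin)
open import Data.List.Relation.Binary.Subset.Propositional using (_⊆_)
open import Data.List.Relation.Unary.All as All using ()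
open import Data.List.Relation.Unary.AllPairs using (_∷_; [])
open import Data.List.Relation.Unary.Any using (here; there; _─_)
open import Data.List.Relation.Unary.Unique.Propositional using (Unique)
import Data.List.Relation.Unary.Unique.Propositional.Properties as Unique
open import Data.Nat using (ℕ; zero; suc; _+_; _*_; _∸_; _<_; _≤_; z≤n; s≤s; s≤s⁻¹; NonZero)
open import Data.Nat.DivMod
open import Data.Nat.Divisibility using (_∣_; ∣m∣n⇒∣m+n; n∣m*n; ∣-refl)
open import Data.Nat.Properties
  using (+-suc; +-comm; +-assoc; +-identityʳ; +-mono-≤; +-cancelʳ-≤; *-monoʳ-≤; *-distribˡ-+;
         ≤-trans; ≤-reflexive; ≤-<-trans; m≤n⇒m≤1+n; m≤n⇒m<n∨m≡n; m≤m+n; m≤n+m∸n;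
         m+[n∸m]≡n; m∸n+n≡m; m+n≤o⇒m≤o∸n; module ≤-Reasoning)
open import Data.Product using (_×_; _,_; proj₁; proj₂)
open import Data.Sum using (_⊎_; inj₁; inj₂)
open import Function using (_∘_)
open import Function.Bundles using (Equivalence)
open import Function.Definitions using (Injective)
open import Level using (0ℓ)
open import Relation.Binary.PropositionalEquality
  using (_≡_; _≢_; refl; sym; trans; cong; subst; module ≡-Reasoning)
open import Relation.Nullary using (¬_; yes; no; contradiction)
open import Relation.Unary using (Pred; Decidable)

∈-─⁺ : ∀ {A : Set} {x y : A} {ys} (x∈ys : x ∈ ys) → y ∈ ys → y ≢ x → y ∈ (ys ─ x∈ys)
∈-─⁺ (here refl) (here refl) y≢x = contradiction refl y≢x
∈-─⁺ (here refl) (there y∈ys) _  = y∈ys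
∈-─⁺ (there x∈ys) (here refl) _   = here refl
∈-─⁺ (there x∈ys) (there y∈ys) y≢x = there (∈-─⁺ x∈ys y∈ys y≢x)

Unique⇒length-≤ : ∀ {A : Set} {xs ys : List A} → Unique xs → xs ⊆ ys → length xs ≤ length ys
Unique⇒length-≤ {xs = []} _ _ = z≤n
Unique⇒length-≤ {xs = x ∷ xs} {ys} (x∉xs ∷ xs!) xs⊆ys = ≤-trans
  (s≤s (Unique⇒length-≤ xs! λ y∈xs → ∈-─⁺ x∈ys (xs⊆ys (there y∈xs)) λ { refl → All.lookup x∉xs y∈xs refl }))
  (≤-reflexive (sym (length-removeAt′ ys _)))
  where x∈ys = xs⊆ys (here refl)

module _ {A : Set} {P Q R : Pred A 0ℓ} (P? : Decidable P) (Q? : Decidable Q) (R? : Decidable R)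
         (P⊎Q : ∀ x → P x ⊎ Q x) (R⇒P×Q : ∀ x → R x → P x × Q x) where

  length-filter-+-≤ : ∀ xs → length (filter R? xs) + length xs ≤ length (filter P? xs) + length (filter Q? xs)
  length-filter-+-≤ [] = z≤n
  length-filter-+-≤ (x ∷ xs) with ih ← length-filter-+-≤ xs | R? x | P? x | Q? x
  ... | yes r | yes _ | yes _ rewrite +-suc (length (filter R? xs)) (length xs)
                                   | +-suc (length (filter P? xs)) (length (filter Q? xs)) = s≤s (s≤s ih)
  ... | yes r | no ¬p | _     = contradiction (proj₁ (R⇒P×Q x r)) ¬p
  ... | yes r | _     | no ¬q = contradiction (proj₂ (R⇒P×Q x r)) ¬q
  ... | no _ | yes _ | yes _ rewrite +-suc (length (filter R? xs)) (length xs)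
                                  | +-suc (length (filter P? xs)) (length (filter Q? xs)) = s≤s (m≤n⇒m≤1+n ih)
  ... | no _ | yes _ | no _ rewrite +-suc (length (filter R? xs)) (length xs) = s≤s ih
  ... | no _ | no _ | yes _ rewrite +-suc (length (filter R? xs)) (length xs)
                                 | +-suc (length (filter P? xs)) (length (filter Q? xs)) = s≤s ih
  ... | no _ | no ¬p | no ¬q with P⊎Q x
  ...   | inj₁ p = contradiction p ¬p
  ...   | inj₂ q = contradiction q ¬q

length-filter-allFin-≤ : ∀ {m n} {P : Pred (Fin m) 0ℓ} {Q : Pred (Fin n) 0ℓ} (P? : Decidable P) (Q? : Decidable Q)
  (f : Fin m → Fin n) → Injective _≡_ _≡_ f → (∀ {x} → P x → Q (f x)) →
  length (filter P? (allFin m)) ≤ length (filter Q? (allFin n))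
length-filter-allFin-≤ {m} P? Q? f f-inj P⇒Q∘f =
  subst (_≤ _) (length-map f (filter P? (allFin m)))
    (Unique⇒length-≤ (Unique.map⁺ f-inj (Unique.filter⁺ P? (Unique.allFin⁺ m))) f[P]⊆Q)
  where
  f[P]⊆Q : map f (filter P? (allFin m)) ⊆ filter Q? (allFin _)
  f[P]⊆Q y∈ with ∈-map⁻ f y∈
  ... | x , x∈ , refl = ∈-filter⁺ Q? (∈-allFin (f x)) (P⇒Q∘f (proj₂ (∈-filter⁻ P? {xs = allFin m} x∈)))

count-≤-injective : ∀ {m n} {p : Fin m → Bool} {q : Fin n → Bool} (f : Fin m → Fin n) →
  Injective _≡_ _≡_ f → (∀ {x} → T (p x) → T (q (f x))) → count p ≤ count q
count-≤-injective = length-filter-allFin-≤ _ _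

count-+-≤ : ∀ {n} {p q r : Fin n → Bool} → (∀ x → T (p x) ⊎ T (q x)) → (∀ x → T (r x) → T (p x) × T (q x)) →
  count r + n ≤ count p + count q
count-+-≤ {n} {p} {q} {r} p⊎q r⇒p×q =
  subst (λ l → count r + l ≤ count p + count q) (length-tabulate (λ x → x)) (length-filter-+-≤ _ _ _ p⊎q r⇒p×q (allFin n))

[m%n+o]%n≡[m+o]%n : ∀ m o n .{{_ : NonZero n}} → (m % n + o) % n ≡ (m + o) % n
[m%n+o]%n≡[m+o]%n m o n = begin
  (m % n + o) % n           ≡⟨ %-distribˡ-+ (m % n) o n ⟩
  (m % n % n + o % n) % n   ≡⟨ cong (λ x → (x + o % n) % n) (m%n%n≡m%n m n) ⟩
  (m % n + o % n) % n       ≡⟨ %-distribˡ-+ m o n ⟨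
  (m + o) % n               ∎
  where open ≡-Reasoning

n∣m+[n∸m%n] : ∀ m n .{{_ : NonZero n}} → n ∣ m + (n ∸ m % n)
n∣m+[n∸m%n] m n = subst (n ∣_) (sym m+[n∸m%n]≡[m/n]*n+n) (∣m∣n⇒∣m+n (n∣m*n (m / n)) ∣-refl)
  where
  open ≡-Reasoning
  m+[n∸m%n]≡[m/n]*n+n : m + (n ∸ m % n) ≡ m / n * n + n
  m+[n∸m%n]≡[m/n]*n+n = begin
    m + (n ∸ m % n)                   ≡⟨ cong (_+ (n ∸ m % n)) (m≡m%n+[m/n]*n m n) ⟩
    m % n + m / n * n + (n ∸ m % n)   ≡⟨ cong (_+ (n ∸ m % n)) (+-comm (m % n) _) ⟩
    m / n * n + m % n + (n ∸ m % n)   ≡⟨ +-assoc (m / n * n) _ _ ⟩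
    m / n * n + (m % n + (n ∸ m % n)) ≡⟨ cong (m / n * n +_) (m+[n∸m]≡n (m%n≤n m n)) ⟩
    m / n * n + n                     ∎

[[m+t]%n+[n∸t%n]]%n≡m : ∀ {m} t n .{{_ : NonZero n}} → m < n → ((m + t) % n + (n ∸ t % n)) % n ≡ m
[[m+t]%n+[n∸t%n]]%n≡m {m} t n m<n = begin
  ((m + t) % n + (n ∸ t % n)) % n ≡⟨ [m%n+o]%n≡[m+o]%n (m + t) (n ∸ t % n) n ⟩
  (m + t + (n ∸ t % n)) % n       ≡⟨ cong (_% n) (+-assoc m t _) ⟩
  (m + (t + (n ∸ t % n))) % n     ≡⟨ %-remove-+ʳ m (n∣m+[n∸m%n] t n) ⟩
  m % n                           ≡⟨ m<n⇒m%n≡m m<n ⟩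
  m                               ∎
  where open ≡-Reasoning

%-cancelʳ-+ : ∀ {a b} t n .{{_ : NonZero n}} → a < n → b < n → (a + t) % n ≡ (b + t) % n → a ≡ b
%-cancelʳ-+ t n a<n b<n eq = begin
  _                               ≡⟨ [[m+t]%n+[n∸t%n]]%n≡m t n a<n ⟨
  ((_ + t) % n + (n ∸ t % n)) % n ≡⟨ cong (λ x → (x + (n ∸ t % n)) % n) eq ⟩
  ((_ + t) % n + (n ∸ t % n)) % n ≡⟨ [[m+t]%n+[n∸t%n]]%n≡m t n b<n ⟩
  _                               ∎
  where open ≡-Reasoning

module _ {m : ℕ} where

  toℕ-sucMod : (i : Fin (suc m)) → toℕ (sucMod i) ≡ suc (toℕ i) % suc m
  toℕ-sucMod i = toℕ-fromℕ< _

  toℕ-addMod : (i : Fin (suc m)) (t : ℕ) → toℕ (addMod i t) ≡ (toℕ i + t) % suc m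
  toℕ-addMod i t = toℕ-fromℕ< _

  addMod-identityʳ : (i : Fin (suc m)) → addMod i 0 ≡ i
  addMod-identityʳ i = toℕ-injective (begin
    toℕ (addMod i 0)      ≡⟨ toℕ-addMod i 0 ⟩
    (toℕ i + 0) % suc m   ≡⟨ cong (_% suc m) (+-identityʳ (toℕ i)) ⟩
    toℕ i % suc m         ≡⟨ m<n⇒m%n≡m (toℕ<n i) ⟩
    toℕ i                 ∎)
    where open ≡-Reasoning

  sucMod-addMod : (i : Fin (suc m)) (t : ℕ) → sucMod (addMod i t) ≡ addMod i (suc t)
  sucMod-addMod i t = toℕ-injective (begin
    toℕ (sucMod (addMod i t))        ≡⟨ toℕ-sucMod (addMod i t) ⟩
    suc (toℕ (addMod i t)) % suc m   ≡⟨ cong (λ x → suc x % suc m) (toℕ-addMod i t) ⟩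
    suc ((toℕ i + t) % suc m) % suc m ≡⟨ cong (_% suc m) (+-comm 1 _) ⟩
    ((toℕ i + t) % suc m + 1) % suc m ≡⟨ [m%n+o]%n≡[m+o]%n (toℕ i + t) 1 (suc m) ⟩
    (toℕ i + t + 1) % suc m           ≡⟨ cong (_% suc m) (trans (+-comm _ 1) (sym (+-suc (toℕ i) t))) ⟩
    (toℕ i + suc t) % suc m           ≡⟨ toℕ-addMod i (suc t) ⟨
    toℕ (addMod i (suc t))            ∎)
    where open ≡-Reasoning

  addMod-injectiveˡ : (t : ℕ) → Injective _≡_ _≡_ (λ (i : Fin (suc m)) → addMod i t)
  addMod-injectiveˡ t {i} {j} eq = toℕ-injective (%-cancelʳ-+ t (suc m) (toℕ<n i) (toℕ<n j) (begin
    (toℕ i + t) % suc m ≡⟨ toℕ-addMod i t ⟨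
    toℕ (addMod i t)    ≡⟨ cong toℕ eq ⟩
    toℕ (addMod j t)    ≡⟨ toℕ-addMod j t ⟩
    (toℕ j + t) % suc m ∎))
    where open ≡-Reasoning

  addMod-injectiveʳ : (i : Fin (suc m)) {s t : ℕ} → s < suc m → t < suc m → addMod i s ≡ addMod i t → s ≡ t
  addMod-injectiveʳ i {s} {t} s<n t<n eq = %-cancelʳ-+ (toℕ i) (suc m) s<n t<n (begin
    (s + toℕ i) % suc m ≡⟨ cong (_% suc m) (+-comm s (toℕ i)) ⟩
    (toℕ i + s) % suc m ≡⟨ toℕ-addMod i s ⟨
    toℕ (addMod i s)    ≡⟨ cong toℕ eq ⟩
    toℕ (addMod i t)    ≡⟨ toℕ-addMod i t ⟩
    (toℕ i + t) % suc m ≡⟨ cong (_% suc m) (+-comm (toℕ i) t) ⟩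
    (t + toℕ i) % suc m ∎)
    where open ≡-Reasoning

module _ {N : ℕ} (G : Colouring N) {m : ℕ} {c : Fin (suc m) → Fin N} (c-injective : Injective _≡_ _≡_ c)
         {a : Fin N} (c≢a : ∀ i → c i ≢ a) (c-red : ∀ i → IsRed G (c i) (c (sucMod i)))
         {L : ℕ} (L<m : L < suc m) (x : Fin (suc m))
         (ax-red : red G a (c x) ≡ true) (axL-red : red G a (c (addMod x L)) ≡ true) where

  -- Indices 0, 1, …, L + 1 list the cycle a, c x, c (x + 1), …, c (x + L); larger ones are irrelevant.
  closedArc : ℕ → Fin N
  closedArc zero    = a
  closedArc (suc t) = c (addMod x t)

  closedArc-injective : ∀ {s t} → s ≤ suc L → t ≤ suc L → closedArc s ≡ closedArc t → s ≡ t
  closedArc-injective {zero}  {zero}  _ _ _  = refl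
  closedArc-injective {zero}  {suc t} _ _ eq = contradiction (sym eq) (c≢a _)
  closedArc-injective {suc s} {zero}  _ _ eq = contradiction eq (c≢a _)
  closedArc-injective {suc s} {suc t} s≤ t≤ eq = cong suc
    (addMod-injectiveʳ x (≤-<-trans (s≤s⁻¹ s≤) L<m) (≤-<-trans (s≤s⁻¹ t≤) L<m) (c-injective eq))

  closedArc-red : ∀ t → t ≤ suc L → IsRed G (closedArc t) (closedArc (suc t % suc (suc L)))
  closedArc-red zero _ =
    (λ eq → c≢a _ (sym eq)) , subst (λ i → red G a (c i) ≡ true) (sym (addMod-identityʳ x)) ax-red
  closedArc-red (suc s) s≤ with m≤n⇒m<n∨m≡n (s≤s⁻¹ s≤)
  ... | inj₁ s<L rewrite m<n⇒m%n≡m (s≤s (s≤s s<L)) =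
    subst (λ i → IsRed G (c (addMod x s)) (c i)) (sucMod-addMod x s) (c-red (addMod x s))
  ... | inj₂ refl = subst (λ t → IsRed G (c (addMod x s)) (closedArc t)) (sym (n%n≡0 (suc (suc s))))
    (c≢a _ , trans (Colouring.sym G (c (addMod x s)) a) axL-red)

  closedArc-cycle : HasRedCycle G (suc (suc L))
  closedArc-cycle = cycle , cycle-injective , cycle-red
    where
    cycle : Fin (suc (suc L)) → Fin N
    cycle i = closedArc (toℕ i)
    cycle-injective : Injective _≡_ _≡_ cycle
    cycle-injective {i} {j} eq = toℕ-injective (closedArc-injective (s≤s⁻¹ (toℕ<n i)) (s≤s⁻¹ (toℕ<n j)) eq)
    cycle-red : ∀ i → IsRed G (cycle i) (cycle (sucMod i))
    cycle-red i = subst (λ t → IsRed G (cycle i) (closedArc t)) (sym (toℕ-sucMod i)) (closedArc-red (toℕ i) (s≤s⁻¹ (toℕ<n i)))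

T-not⊎T-not : ∀ b b' → (b ≡ true → b' ≡ true → ⊥) → T (not b) ⊎ T (not b')
T-not⊎T-not true  true  ¬both = contradiction refl (¬both refl)
T-not⊎T-not true  false _     = inj₂ _
T-not⊎T-not false _     _     = inj₁ _

T-=ᵇ⇒T-not×T-not : ∀ b b' → (b ≡ true → b' ≡ true → ⊥) → T (b =ᵇ b') → T (not b) × T (not b')
T-=ᵇ⇒T-not×T-not true  true  ¬both _ = contradiction refl (¬both refl)
T-=ᵇ⇒T-not×T-not false false _     _ = _ , _

IsBlue⇒T-blue? : ∀ {N} (G : Colouring N) {u w} → IsBlue G u w → T (blue? G u w)
IsBlue⇒T-blue? G {u} {w} (u≢w , uw-blue) with u Fin.≟ w
... | yes u≡w = contradiction u≡w u≢w
... | no _    = Equivalence.from T-not-≡ uw-blue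

agreements-+-length-≤ : ∀ {N M} (G : Colouring N) (v a : Fin N) {c : Fin M → Fin N} → Injective _≡_ _≡_ c →
  (∀ i → IsBlue G v (c i)) → (∀ i → c i ≢ a) → (∀ i → IsRed G (c i) (c (sucMod i))) →
  ∀ {L} → L < M → ¬ HasRedCycle G (suc (suc L)) →
  count (λ x → red G a (c x) =ᵇ red G a (c (addMod x L))) + M ≤ blueDegIn G v a + blueDegIn G v a
agreements-+-length-≤ {M = zero}  G v a _ _ _ _ _ _ = z≤n
agreements-+-length-≤ {M = suc m} G v a {c} c-injective c-blue c≢a c-red {L} L<M no-cycle = ≤-trans
  (count-+-≤ (λ x → T-not⊎T-not _ _ (not-both-red x)) (λ x → T-=ᵇ⇒T-not×T-not _ _ (not-both-red x)))
  (+-mono-≤ (count-≤-injective c c-injective blue-in-H)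
            (count-≤-injective (λ x → c (addMod x L)) (addMod-injectiveˡ L ∘ c-injective) blue-in-H))
  where
  not-both-red : ∀ x → red G a (c x) ≡ true → red G a (c (addMod x L)) ≡ true → ⊥
  not-both-red x ax-red axL-red = no-cycle (closedArc-cycle G c-injective c≢a c-red L<M x ax-red axL-red)
  blue-in-H : ∀ {i} → T (not (red G a (c i))) → T (blue? G v (c i) ∧ blue? G a (c i))
  blue-in-H {i} t = Equivalence.from T-∧
    (IsBlue⇒T-blue? G (c-blue i) , IsBlue⇒T-blue? G ((λ eq → c≢a i (sym eq)) , Equivalence.to T-not-≡ t))

lemma19 : (j k : ℕ) → k + 250 < j → 2 * j < 3 * k → 212299 ≤ j → 141534 ≤ k →
    (G : Colouring (4 * j + 1)) →
    ¬ HasRedCycle G (2 * k + 1) →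
    ¬ HasBlueWheel G (2 * j) →
    (v : Fin (4 * j + 1)) → (∀ w → blueDeg G w ≤ blueDeg G v) →
    (a b : Fin (4 * j + 1)) → IsBlue G v a → IsBlue G v b → IsRed G a b →
    blueDegIn G v a < j → blueDegIn G v b < j →
    (c : Fin (2 * j ∸ 502) → Fin (4 * j + 1)) →
    Injective _≡_ _≡_ c →
    (∀ i → IsBlue G v (c i)) → (∀ i → c i ≢ a) → (∀ i → c i ≢ b) →
    (∀ i → IsRed G (c i) (c (sucMod i))) →
    count (λ x → red G a (c x) =ᵇ red G a (c (addMod x (2 * k ∸ 1)))) ≤ 500
      × count (λ x → red G b (c x) =ᵇ red G b (c (addMod x (2 * k ∸ 1)))) ≤ 500
lemma19 j k k+250<j _ _ 141534≤k G no-odd-cycle _ v _ a b _ _ _ deg-a deg-b c c-injective c-blue c≢a c≢b c-red =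
  few-agreements deg-a c≢a , few-agreements deg-b c≢b
  where
  M = 2 * j ∸ 502

  suc[2k∸1]≡2k : suc (2 * k ∸ 1) ≡ 2 * k
  suc[2k∸1]≡2k = trans (+-comm 1 _) (m∸n+n≡m (≤-trans (s≤s z≤n) (≤-trans 141534≤k (m≤m+n k _))))

  2k∸1<M : 2 * k ∸ 1 < M
  2k∸1<M = subst (_≤ M) (sym suc[2k∸1]≡2k) (m+n≤o⇒m≤o∸n (2 * k)
    (subst (_≤ 2 * j) (*-distribˡ-+ 2 k 251) (*-monoʳ-≤ 2 (subst (_≤ j) (sym (+-suc k 250)) k+250<j))))

  no-cycle : ¬ HasRedCycle G (suc (suc (2 * k ∸ 1)))
  no-cycle = no-odd-cycle ∘ subst (HasRedCycle G) (trans (cong suc suc[2k∸1]≡2k) (+-comm 1 (2 * k)))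

  e+M≤z+z⇒e≤500 : ∀ {e z} → e + M ≤ z + z → z < j → e ≤ 500
  e+M≤z+z⇒e≤500 {e} {z} e+M≤z+z z<j = s≤s⁻¹ (s≤s⁻¹ (+-cancelʳ-≤ M (2 + e) 502 (begin
    2 + e + M     ≤⟨ s≤s (s≤s e+M≤z+z) ⟩
    2 + (z + z)   ≡⟨ cong suc (+-suc z z) ⟨
    suc z + suc z ≤⟨ +-mono-≤ z<j z<j ⟩
    j + j         ≡⟨ cong (j +_) (+-identityʳ j) ⟨
    2 * j         ≤⟨ m≤n+m∸n (2 * j) 502 ⟩
    502 + M       ∎)))
    where open ≤-Reasoning

  few-agreements : ∀ {u} → blueDegIn G v u < j → (∀ i → c i ≢ u) →
    count (λ x → red G u (c x) =ᵇ red G u (c (addMod x (2 * k ∸ 1)))) ≤ 500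
  few-agreements {u} deg c≢u =
    e+M≤z+z⇒e≤500 (agreements-+-length-≤ G v u c-injective c-blue c≢u c-red 2k∸1<M no-cycle) deg
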